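{- Let $k\ge 0$ and let $G$ be a $B_k$-EPG graph on $n$ vertices. Then $G$ has at most $(k+1)(\omega(G)-1)n$ edges, where $\omega(G)$ is the maximum size of a clique of $G$.
   Context: An EPG representation of a graph $G$ assigns to every vertex $u$ a path $P_u$ in the rectangular grid, such that two distinct vertices $u,v$ are adjacent in $G$ iff $P_u$ and $P_v$ share at least one grid edge. A bend of a path is a grid point where it turns between horizontal and vertical. $G$ is a $B_k$-EPG graph if it admits an EPG representation in which every path has at most $k$ bends. -}

module Defs where

open import Data.Nat using (ℕ; zero; suc; _+_; _*_; _∸_; _≤_; _<ᵇ_)
open import Data.Integer using (ℤ) renaming (_+_ to _+ℤ_)
open import Data.Integer.Properties using () renaming (_≟_ to _≟ℤ_)
open import Data.Bool using (Bool; true; false; _∧_; _xor_)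
open import Data.Fin using (Fin; toℕ)
open import Data.Fin.Subset using (Subset; _∈_; ∣_∣)
open import Data.List using (List; []; _∷_; length; filterᵇ; cartesianProduct; allFin)
open import Data.List.Relation.Unary.Unique.Propositional using (Unique)
open import Data.Product using (_×_; _,_; proj₁; proj₂; Σ; ∃; ∃-syntax)
open import Data.Sum using (_⊎_)
open import Relation.Nullary using (¬_; ⌊_⌋)
open import Relation.Binary.PropositionalEquality using (_≡_)
open import Function.Bundles using (_⇔_)

record Graph (n : ℕ) : Set where
  field
    adj   : Fin n → Fin n → Bool
    sym   : ∀ u v → adj u v ≡ adj v u
    irrefl : ∀ u → adj u u ≡ false
open Graph public

numEdges : ∀ {n} → Graph n → ℕ
numEdges {n} G =
  length (filterᵇ (λ p → (toℕ (proj₁ p) <ᵇ toℕ (proj₂ p)) ∧ adj G (proj₁ p) (proj₂ p))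
                  (cartesianProduct (allFin n) (allFin n)))

IsClique : ∀ {n} → Graph n → Subset n → Set
IsClique G S = ∀ u v → u ∈ S → v ∈ S → ¬ (u ≡ v) → adj G u v ≡ true

IsCliqueNumber : ∀ {n} → Graph n → ℕ → Set
IsCliqueNumber G w =
  (∃[ S ] (IsClique G S × ∣ S ∣ ≡ w)) × (∀ S → IsClique G S → ∣ S ∣ ≤ w)

Point : Set
Point = ℤ × ℤ

GridAdj : Point → Point → Set
GridAdj (x , y) (x' , y') =
  (y ≡ y' × (x' ≡ x +ℤ ℤ.pos 1 ⊎ x ≡ x' +ℤ ℤ.pos 1)) ⊎
  (x ≡ x' × (y' ≡ y +ℤ ℤ.pos 1 ⊎ y ≡ y' +ℤ ℤ.pos 1))

data Walk : List Point → Set where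
  single : ∀ p → Walk (p ∷ [])
  step   : ∀ {p q rest} → GridAdj p q → Walk (q ∷ rest) → Walk (p ∷ q ∷ rest)

IsGridPath : List Point → Set
IsGridPath P = Walk P × Unique P

data UsesEdge : List Point → Point → Point → Set where
  hereₗ : ∀ {p q rest} → UsesEdge (p ∷ q ∷ rest) p q
  hereᵣ : ∀ {p q rest} → UsesEdge (p ∷ q ∷ rest) q p
  there : ∀ {p rest a b} → UsesEdge rest a b → UsesEdge (p ∷ rest) a b

horizontal : Point → Point → Bool
horizontal p q = ⌊ proj₂ p ≟ℤ proj₂ q ⌋

bends : List Point → ℕ
bends (p ∷ q ∷ r ∷ rest) =
  (if horizontal p q xor horizontal q r then 1 else 0) + bends (q ∷ r ∷ rest)
  where open import Data.Bool using (if_then_else_)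
bends _ = 0

record EPGRep {n : ℕ} (G : Graph n) : Set where
  field
    path    : Fin n → List Point
    isPath  : ∀ u → IsGridPath (path u)
    correct : ∀ u v → ¬ (u ≡ v) →
              (adj G u v ≡ true ⇔ (∃[ p ] ∃[ q ] (UsesEdge (path u) p q × UsesEdge (path v) p q)))
open EPGRep public

IsBkEPG : ℕ → ∀ {n} → Graph n → Set
IsBkEPG k G = ∃[ R ] (∀ u → bends (path {G = G} R u) ≤ k)

module Submission where

-- Cut every path into maximal straight segments and mark the lowest unit edge of each, so a path
-- with at most k bends has at most k + 1 marked edges. If the paths of u and v share a grid edge,
-- then a shared edge of least height is marked on one of them: otherwise the edge just below it
-- would be shared as well. Hence every edge uv of G is charged to a pair (x, e) with e marked on
-- the path of x and used by the path of the other endpoint. The paths through a grid edge form a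
-- clique, so each of the at most (k + 1) n pairs receives at most ω − 1 charges.

open import Defs hiding (sym)
open import Data.Bool.Base using (Bool; true; false; not; _∧_; _∨_; _xor_; if_then_else_)
open import Data.Bool.ListAction using (any)
open import Data.Bool.Properties using (∨-zeroʳ; T-≡) renaming (_≟_ to _≟ᵇ_)
open import Data.Empty using (⊥; ⊥-elim)
open import Data.Fin.Base using (Fin; zero; suc; toℕ)
import Data.Fin.Subset as Subset
open import Data.Integer.Base as ℤ using (ℤ; 1ℤ; pred)
import Data.Integer.Properties as ℤₚ
open import Data.List.Base using (List; []; _∷_; _++_; length; map; head; filter; filterᵇ;
  cartesianProduct; allFin; tabulate)
open import Data.List.Extrema ℤₚ.≤-totalOrder using (argmin; argmin-all; f[argmin]≤f[xs])
open import Data.List.Membership.Propositional using (_∈_)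
open import Data.List.Membership.Propositional.Properties using (∈-filter⁺; ∈-filter⁻)
import Data.List.Membership.DecPropositional as DecMembership
open import Data.List.Properties using (map-++; map-∘; map-tabulate)
import Data.List.Relation.Unary.All as All
open All using (_∷_)
open import Data.List.Relation.Unary.Any using (here; there)
open import Data.List.Relation.Unary.AllPairs using (_∷_)
open import Data.List.Relation.Unary.Unique.Propositional using (Unique)
open import Data.Maybe.Base using (Maybe; just; nothing)
open import Data.Nat.Base using (ℕ; zero; suc; _+_; _*_; _∸_; _≤_; z≤n; s≤s; s≤s⁻¹; _<ᵇ_)
open import Data.Nat.ListAction using (sum)
open import Data.Nat.ListAction.Properties using (sum-++)
open import Data.Nat.Properties using (≤-refl; ≤-trans; ≤-reflexive; +-mono-≤; +-suc; +-identityʳ;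
  m≤n+m; *-comm; *-monoˡ-≤; ∸-monoˡ-≤; <ᵇ⇒<; <-irrefl; <-asym; +-0-commutativeMonoid;
  module ≤-Reasoning)
open import Algebra.Properties.CommutativeMonoid.Sum +-0-commutativeMonoid
  using (sum-syntax; sum-cong-≗; ∑-distrib-+; ∑-comm; sum-replicate-zero)
open import Data.Product.Base using (_×_; _,_; proj₁; proj₂; ∃-syntax; ∃₂)
open import Data.Product.Properties using (≡-dec)
open import Data.Sum.Base as Sum using (_⊎_; inj₁; inj₂; swap)
import Data.Vec.Base as Vec
open import Data.Vec.Properties using ([]=⇒lookup; lookup∘tabulate)
open import Function.Base using (_∘_)
open import Function.Bundles using (Equivalence)
open import Relation.Binary.Definitions using (DecidableEquality)
open import Relation.Binary.PropositionalEquality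
  using (_≡_; _≢_; refl; sym; trans; cong; cong₂; subst; module ≡-Reasoning)
open import Relation.Nullary using (Dec; yes; no; does)
open import Relation.Nullary.Decidable using (dec-true; dec-false; isYes≗does)

does⇒ : ∀ {A : Set} (a? : Dec A) → does a? ≡ true → A
does⇒ (yes a) _ = a

-- Grid geometry

pred[i+1]≡i : ∀ i → pred (i ℤ.+ 1ℤ) ≡ i
pred[i+1]≡i i = trans (cong pred (ℤₚ.+-comm i 1ℤ)) (ℤₚ.pred-suc i)

pred[i]+1≡i : ∀ i → pred i ℤ.+ 1ℤ ≡ i
pred[i]+1≡i i = trans (ℤₚ.+-comm (pred i) 1ℤ) (ℤₚ.suc-pred i)

i<i+1 : ∀ i → i ℤ.< i ℤ.+ 1ℤ
i<i+1 i = ℤₚ.suc[i]≤j⇒i<j (ℤₚ.≤-reflexive (ℤₚ.+-comm 1ℤ i))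

pred[i]<i : ∀ i → pred i ℤ.< i
pred[i]<i i = ℤₚ.i≤pred[j]⇒i<j ℤₚ.≤-refl

data Axis : Set where
  x-axis y-axis : Axis

_≟ₐ_ : DecidableEquality Axis
x-axis ≟ₐ x-axis = yes refl
x-axis ≟ₐ y-axis = no λ ()
y-axis ≟ₐ x-axis = no λ ()
y-axis ≟ₐ y-axis = yes refl

isHorizontal : Axis → Bool
isHorizontal x-axis = true
isHorizontal y-axis = false

-- The Bool says whether the coordinate increases.
Dir : Set
Dir = Axis × Bool

pattern east  = x-axis , true
pattern west  = x-axis , false
pattern north = y-axis , true
pattern south = y-axis , false

_≟ᵈ_ : DecidableEquality Dir
_≟ᵈ_ = ≡-dec _≟ₐ_ _≟ᵇ_

reverse : Dir → Dir
reverse (a , s) = a , not s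

move : Point → Dir → Point
move (x , y) east  = x ℤ.+ 1ℤ , y
move (x , y) west  = pred x , y
move (x , y) north = x , y ℤ.+ 1ℤ
move (x , y) south = x , pred y

move-reverse : ∀ p d → move (move p d) (reverse d) ≡ p
move-reverse (x , y) east  = cong (_, y) (pred[i+1]≡i x)
move-reverse (x , y) west  = cong (_, y) (pred[i]+1≡i x)
move-reverse (x , y) north = cong (x ,_) (pred[i+1]≡i y)
move-reverse (x , y) south = cong (x ,_) (pred[i]+1≡i y)

after : Point → List Dir → List Point
after p []       = []
after p (d ∷ ds) = move p d ∷ after (move p d) ds

trace : Point → List Dir → List Point
trace p ds = p ∷ after p ds

direction : ∀ {p q} → GridAdj p q → Dir
direction (inj₁ (_ , inj₁ _)) = east
direction (inj₁ (_ , inj₂ _)) = west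
direction (inj₂ (_ , inj₁ _)) = north
direction (inj₂ (_ , inj₂ _)) = south

move-direction : ∀ {p q} (g : GridAdj p q) → move p (direction g) ≡ q
move-direction {_ , _} (inj₁ (y≡y' , inj₁ x'≡x+1)) = cong₂ _,_ (sym x'≡x+1) y≡y'
move-direction {_ , _} (inj₁ (y≡y' , inj₂ x≡x'+1)) =
  cong₂ _,_ (trans (cong pred x≡x'+1) (pred[i+1]≡i _)) y≡y'
move-direction {_ , _} (inj₂ (x≡x' , inj₁ y'≡y+1)) = cong₂ _,_ x≡x' (sym y'≡y+1)
move-direction {_ , _} (inj₂ (x≡x' , inj₂ y≡y'+1)) =
  cong₂ _,_ x≡x' (trans (cong pred y≡y'+1) (pred[i+1]≡i _))

walk-trace : ∀ {P} → Walk P → ∃₂ λ p ds → P ≡ trace p ds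
walk-trace (single p) = p , [] , refl
walk-trace (step {p} g w) with walk-trace w
... | q , ds , refl = p , direction g ∷ ds , cong (λ r → p ∷ trace r ds) (sym (move-direction g))

-- A unit edge is given by its lower endpoint and its axis.
UnitEdge : Set
UnitEdge = Point × Axis

_≟ₑ_ : DecidableEquality UnitEdge
_≟ₑ_ = ≡-dec (≡-dec ℤₚ._≟_ ℤₚ._≟_) _≟ₐ_

tip : UnitEdge → Point
tip (p , a) = move p (a , true)

predEdge : UnitEdge → UnitEdge
predEdge (p , a) = move p (a , false) , a

height : UnitEdge → ℤ
height ((x , _) , x-axis) = x
height ((_ , y) , y-axis) = y

height-predEdge< : ∀ e → height (predEdge e) ℤ.< height e
height-predEdge< ((x , _) , x-axis) = pred[i]<i x
height-predEdge< ((_ , y) , y-axis) = pred[i]<i y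

stepEdge : Point → Dir → UnitEdge
stepEdge p (a , true)  = p , a
stepEdge p (a , false) = predEdge (p , a)

stepEdge-reverse : ∀ p d → stepEdge (move p d) (reverse d) ≡ stepEdge p d
stepEdge-reverse p (a , true)  = cong (_, a) (move-reverse p (a , true))
stepEdge-reverse p (a , false) = refl

stepEdges : Point → List Dir → List UnitEdge
stepEdges p []       = []
stepEdges p (d ∷ ds) = stepEdge p d ∷ stepEdges (move p d) ds

Joins : UnitEdge → Point → Point → Set
Joins e a b = (proj₁ e ≡ a × tip e ≡ b) ⊎ (proj₁ e ≡ b × tip e ≡ a)

stepEdge-joins : ∀ p d → Joins (stepEdge p d) p (move p d)
stepEdge-joins p (a , true)  = inj₁ (refl , refl)
stepEdge-joins p (a , false) = inj₂ (refl , move-reverse p (a , false))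

level : Point → ℤ
level (x , y) = x ℤ.+ y

level<level-tip : ∀ e → level (proj₁ e) ℤ.< level (tip e)
level<level-tip ((x , y) , x-axis) = ℤₚ.+-monoˡ-< y (i<i+1 x)
level<level-tip ((x , y) , y-axis) = ℤₚ.+-monoʳ-< x (i<i+1 y)

tip-injective : ∀ p a b → tip (p , a) ≡ tip (p , b) → a ≡ b
tip-injective _       x-axis x-axis _  = refl
tip-injective _       y-axis y-axis _  = refl
tip-injective (x , _) x-axis y-axis eq = ⊥-elim (ℤₚ.<-irrefl (sym (cong proj₁ eq)) (i<i+1 x))
tip-injective (x , _) y-axis x-axis eq = ⊥-elim (ℤₚ.<-irrefl (cong proj₁ eq) (i<i+1 x))

-- The level x + y grows along unit edges, so two unit edges cannot join the same points crosswise.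
tip-tip≢ : ∀ p a b → tip (tip (p , a) , b) ≢ p
tip-tip≢ p a b eq = ℤₚ.<-irrefl (cong level (sym eq))
  (ℤₚ.<-trans (level<level-tip (p , a)) (level<level-tip (tip (p , a) , b)))

joins-unique : ∀ {e e' a b} → Joins e a b → Joins e' a b → e ≡ e'
joins-unique {p , α} {_ , β} (inj₁ (refl , t)) (inj₁ (refl , t')) =
  cong (p ,_) (tip-injective p α β (trans t (sym t')))
joins-unique {p , α} {_ , β} (inj₂ (refl , t)) (inj₂ (refl , t')) =
  cong (p ,_) (tip-injective p α β (trans t (sym t')))
joins-unique {p , α} {_ , β} (inj₁ (refl , refl)) (inj₂ (refl , t')) = ⊥-elim (tip-tip≢ p α β t')
joins-unique {p , α} {_ , β} (inj₂ (refl , refl)) (inj₁ (refl , t')) = ⊥-elim (tip-tip≢ p α β t')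

uses-swap : ∀ {P a b} → UsesEdge P a b → UsesEdge P b a
uses-swap hereₗ     = hereᵣ
uses-swap hereᵣ     = hereₗ
uses-swap (there u) = there (uses-swap u)

joins⇒uses : ∀ {P e a b} → Joins e a b → UsesEdge P a b → UsesEdge P (proj₁ e) (tip e)
joins⇒uses (inj₁ (refl , refl)) u = u
joins⇒uses (inj₂ (refl , refl)) u = uses-swap u

uses⇒stepEdge : ∀ p ds {a b} → UsesEdge (trace p ds) a b → ∃[ e ] e ∈ stepEdges p ds × Joins e a b
uses⇒stepEdge p []       (there ())
uses⇒stepEdge p (d ∷ ds) hereₗ     = stepEdge p d , here refl , stepEdge-joins p d
uses⇒stepEdge p (d ∷ ds) hereᵣ     = stepEdge p d , here refl , swap (stepEdge-joins p d)
uses⇒stepEdge p (d ∷ ds) (there u) with uses⇒stepEdge (move p d) ds u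
... | e , e∈ , joins = e , there e∈ , joins

stepEdge⇒uses : ∀ p ds {e} → e ∈ stepEdges p ds → UsesEdge (trace p ds) (proj₁ e) (tip e)
stepEdge⇒uses p (d ∷ ds) (here refl) = joins⇒uses (stepEdge-joins p d) hereₗ
stepEdge⇒uses p (d ∷ ds) (there e∈) = there (stepEdge⇒uses (move p d) ds e∈)

shared-stepEdge : ∀ p ds q es {a b} → UsesEdge (trace p ds) a b → UsesEdge (trace q es) a b →
  ∃[ e ] e ∈ stepEdges p ds × e ∈ stepEdges q es
shared-stepEdge p ds q es u v with uses⇒stepEdge p ds u | uses⇒stepEdge q es v
... | e , e∈ , joins | e' , e'∈ , joins' = e , e∈ , subst (_∈ _) (sym (joins-unique joins joins')) e'∈

indicator : Bool → ℕ
indicator b = if b then 1 else 0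

indicator≤1 : ∀ b → indicator b ≤ 1
indicator≤1 true  = ≤-refl
indicator≤1 false = z≤n

indicator[true]+m≤1+n⇒m≤n : ∀ {b m n} → b ≡ true → indicator b + m ≤ suc n → m ≤ n
indicator[true]+m≤1+n⇒m≤n refl = s≤s⁻¹

horizontal-move : ∀ p d → horizontal p (move p d) ≡ isHorizontal (proj₁ d)
horizontal-move (_ , y) east  = trans (isYes≗does (y ℤₚ.≟ y)) (dec-true (y ℤₚ.≟ y) refl)
horizontal-move (_ , y) west  = trans (isYes≗does (y ℤₚ.≟ y)) (dec-true (y ℤₚ.≟ y) refl)
horizontal-move (_ , y) north = trans (isYes≗does (y ℤₚ.≟ _))
  (dec-false (y ℤₚ.≟ _) λ eq → ℤₚ.<-irrefl eq (i<i+1 y))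
horizontal-move (_ , y) south = trans (isYes≗does (y ℤₚ.≟ _))
  (dec-false (y ℤₚ.≟ _) λ eq → ℤₚ.<-irrefl (sym eq) (pred[i]<i y))

turns : List Dir → ℕ
turns (d ∷ e ∷ ds) = indicator (not (does (d ≟ᵈ e))) + turns (e ∷ ds)
turns _            = 0

turn≤axis-change : ∀ d e → e ≢ reverse d →
  indicator (not (does (d ≟ᵈ e))) ≤ indicator (isHorizontal (proj₁ d) xor isHorizontal (proj₁ e))
turn≤axis-change (x-axis , _)     (y-axis , _)     _   = ≤-refl
turn≤axis-change (y-axis , _)     (x-axis , _)     _   = ≤-refl
turn≤axis-change east  east  _   = z≤n
turn≤axis-change west  west  _   = z≤n
turn≤axis-change north north _   = z≤n
turn≤axis-change south south _   = z≤n
turn≤axis-change east  west  rev = ⊥-elim (rev refl)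
turn≤axis-change west  east  rev = ⊥-elim (rev refl)
turn≤axis-change north south rev = ⊥-elim (rev refl)
turn≤axis-change south north rev = ⊥-elim (rev refl)

-- A reversal would revisit a point, so on a simple walk every change of direction is a bend.
turns≤bends : ∀ p ds → Unique (trace p ds) → turns ds ≤ bends (trace p ds)
turns≤bends p []           _                       = z≤n
turns≤bends p (d ∷ [])     _                       = z≤n
turns≤bends p (d ∷ e ∷ ds) ((_ ∷ p≢r ∷ _) ∷ unique) =
  +-mono-≤ turn≤bend (turns≤bends (move p d) (e ∷ ds) unique)
  where
  turn≤bend : indicator (not (does (d ≟ᵈ e))) ≤
              indicator (horizontal p (move p d) xor horizontal (move p d) (move (move p d) e))
  turn≤bend rewrite horizontal-move p d | horizontal-move (move p d) e =
    turn≤axis-change d e λ { refl → p≢r (sym (move-reverse p d)) }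

-- Lowest edges of segments

module Survivors {A : Set} (_≟_ : DecidableEquality A) (f : A → A) where

  neighbour : A → Maybe A → Bool
  neighbour x nothing  = false
  neighbour x (just y) = does (x ≟ y)

  neighbour-sound : ∀ x m → neighbour x m ≡ true → just x ≡ m
  neighbour-sound x (just y) eq = cong just (does⇒ (x ≟ y) eq)

  -- prev is the element preceding the list; x survives unless f x is one of its neighbours.
  survivors : Maybe A → List A → List A
  survivors prev []       = []
  survivors prev (x ∷ xs) =
    if neighbour (f x) prev ∨ neighbour (f x) (head xs)
    then survivors (just x) xs
    else x ∷ survivors (just x) xs

  neighbour-refl : ∀ x → neighbour x (just x) ≡ true
  neighbour-refl x = dec-true (x ≟ x) refl

  survivors-head : ∀ prev x xs s →
    indicator (s ∧ neighbour (f x) prev) + length (survivors prev (x ∷ xs)) ≤ suc (length (survivors (just x) xs))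
  survivors-head prev x xs s with neighbour (f x) prev | neighbour (f x) (head xs)
  ... | true  | _     = +-mono-≤ (indicator≤1 (s ∧ true)) ≤-refl
  ... | false | true  = +-mono-≤ (indicator≤1 (s ∧ false)) ≤-refl
  survivors-head prev x xs true  | false | false = ≤-refl
  survivors-head prev x xs false | false | false = ≤-refl

  survivors-skip : ∀ prev x xs → neighbour (f x) (head xs) ≡ true →
    survivors prev (x ∷ xs) ≡ survivors (just x) xs
  survivors-skip prev x xs next rewrite next | ∨-zeroʳ (neighbour (f x) prev) = refl

  survivors-⊆ : ∀ prev xs {y} → y ∈ survivors prev xs → y ∈ xs
  survivors-⊆ prev (x ∷ xs) y∈ with neighbour (f x) prev ∨ neighbour (f x) (head xs)
  survivors-⊆ prev (x ∷ xs) y∈          | true  = there (survivors-⊆ (just x) xs y∈)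
  survivors-⊆ prev (x ∷ xs) (here y≡x)  | false = here y≡x
  survivors-⊆ prev (x ∷ xs) (there y∈)  | false = there (survivors-⊆ (just x) xs y∈)

  survivors-∷ : ∀ prev x xs {y} → y ∈ survivors (just x) xs → y ∈ survivors prev (x ∷ xs)
  survivors-∷ prev x xs y∈ with neighbour (f x) prev ∨ neighbour (f x) (head xs)
  ... | true  = y∈
  ... | false = there y∈

  head-∈ : ∀ (xs : List A) {y} → just y ≡ head xs → y ∈ xs
  head-∈ (x ∷ xs) refl = here refl

  survivor-or-image : ∀ prev xs {x} → x ∈ xs →
    x ∈ survivors prev xs ⊎ f x ∈ xs ⊎ just (f x) ≡ prev
  survivor-or-image prev (x ∷ xs) (here refl)
    with neighbour (f x) prev in before | neighbour (f x) (head xs) in next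
  ... | true  | _     = inj₂ (inj₂ (neighbour-sound _ prev before))
  ... | false | true  = inj₂ (inj₁ (there (head-∈ xs (neighbour-sound _ (head xs) next))))
  ... | false | false = inj₁ (here refl)
  survivor-or-image prev (x ∷ xs) (there x∈) with survivor-or-image (just x) xs x∈
  ... | inj₁ survives      = inj₁ (survivors-∷ prev x xs survives)
  ... | inj₂ (inj₁ fx∈)    = inj₂ (inj₁ (there fx∈))
  ... | inj₂ (inj₂ refl)   = inj₂ (inj₁ (here refl))

  module _ (h : A → ℤ) (h-f : ∀ x → h (f x) ℤ.< h x) where

    -- If f x were shared too, it would be a lower shared element.
    minimal-shared-survives : ∀ {z xs ys} → z ∈ xs → z ∈ ys →
      (∀ {y} → y ∈ xs → y ∈ ys → h z ℤ.≤ h y) →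
      z ∈ survivors nothing xs ⊎ z ∈ survivors nothing ys
    minimal-shared-survives {z} {xs} {ys} z∈xs z∈ys minimal
      with survivor-or-image nothing xs z∈xs | survivor-or-image nothing ys z∈ys
    ... | inj₁ survives     | _                 = inj₁ survives
    ... | inj₂ _            | inj₁ survives     = inj₂ survives
    ... | inj₂ (inj₁ fz∈xs) | inj₂ (inj₁ fz∈ys) = ⊥-elim (ℤₚ.<⇒≱ (h-f z) (minimal fz∈xs fz∈ys))
    ... | inj₂ (inj₂ ())    | inj₂ _
    ... | inj₂ (inj₁ _)     | inj₂ (inj₂ ())

    shared-survivor : ∀ {x xs ys} → x ∈ xs → x ∈ ys →
      ∃[ z ] ((z ∈ survivors nothing xs × z ∈ ys) ⊎ (z ∈ xs × z ∈ survivors nothing ys))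
    shared-survivor {x} {xs} {ys} x∈xs x∈ys =
      z , Sum.map (_, z∈ys) (z∈xs ,_) (minimal-shared-survives z∈xs z∈ys minimal)
      where
      open DecMembership _≟_ using (_∈?_)
      shared = filter (_∈? ys) xs
      z = argmin h x shared
      z∈xs×z∈ys : z ∈ xs × z ∈ ys
      z∈xs×z∈ys = argmin-all h (x∈xs , x∈ys) (All.tabulate (∈-filter⁻ (_∈? ys)))
      z∈xs = proj₁ z∈xs×z∈ys
      z∈ys = proj₂ z∈xs×z∈ys
      minimal : ∀ {y} → y ∈ xs → y ∈ ys → h z ℤ.≤ h y
      minimal y∈xs y∈ys = All.lookup (f[argmin]≤f[xs] x shared) (∈-filter⁺ (_∈? ys) y∈xs y∈ys)

open Survivors _≟ₑ_ predEdge

-- On a straight segment only the lowest edge survives: predEdge of any other edge is an adjacent step.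
lowestEdges : Point → List Dir → List UnitEdge
lowestEdges p ds = survivors nothing (stepEdges p ds)

-- The indicator strengthens the induction: if the walk continues an increasing segment through prev,
-- the lowest edge of that segment has already been counted.
survivors-stepEdges≤turns : ∀ prev p d ds →
  indicator (proj₂ d ∧ neighbour (predEdge (stepEdge p d)) prev) + length (survivors prev (stepEdges p (d ∷ ds)))
  ≤ suc (turns (d ∷ ds))
survivors-stepEdges≤turns prev p d [] = survivors-head prev (stepEdge p d) [] (proj₂ d)
survivors-stepEdges≤turns prev p d (e ∷ ds)
  with d ≟ᵈ e | survivors-stepEdges≤turns (just (stepEdge p d)) (move p d) e ds
... | no _ | ih =
  ≤-trans (survivors-head prev (stepEdge p d) (stepEdges (move p d) (e ∷ ds)) (proj₂ d))
          (s≤s (≤-trans (m≤n+m _ _) ih))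
survivors-stepEdges≤turns prev p (a , true) (_ ∷ ds) | yes refl | ih =
  ≤-trans (survivors-head prev (p , a) (stepEdges (move p (a , true)) ((a , true) ∷ ds)) true)
          (s≤s (indicator[true]+m≤1+n⇒m≤n continues ih))
  where
  continues : neighbour (predEdge (stepEdge (move p (a , true)) (a , true))) (just (p , a)) ≡ true
  continues = dec-true (_ ≟ₑ _) (cong (_, a) (move-reverse p (a , true)))
survivors-stepEdges≤turns prev p (a , false) (_ ∷ ds) | yes refl | ih =
  -- On a decreasing segment predEdge of the first edge is the edge of the next step.
  subst (λ es → length es ≤ _)
        (sym (survivors-skip prev (stepEdge p (a , false)) (stepEdges (move p (a , false)) ((a , false) ∷ ds))
                             (neighbour-refl (stepEdge (move p (a , false)) (a , false)))))
        ih

lowestEdges-length : ∀ p ds → Unique (trace p ds) → length (lowestEdges p ds) ≤ suc (bends (trace p ds))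
lowestEdges-length p []       _      = z≤n
lowestEdges-length p (d ∷ ds) unique =
  ≤-trans (m≤n+m _ _)
          (≤-trans (survivors-stepEdges≤turns nothing p d ds) (s≤s (turns≤bends p (d ∷ ds) unique)))

-- Counting

∑-mono-≤ : ∀ {n} {f g : Fin n → ℕ} → (∀ i → f i ≤ g i) → ∑[ i < n ] f i ≤ ∑[ i < n ] g i
∑-mono-≤ {zero}  _   = z≤n
∑-mono-≤ {suc n} f≤g = +-mono-≤ (f≤g zero) (∑-mono-≤ (f≤g ∘ suc))

∑-≤-* : ∀ {n} {f : Fin n → ℕ} {b} → (∀ i → f i ≤ b) → ∑[ i < n ] f i ≤ n * b
∑-≤-* {zero}  _   = z≤n
∑-≤-* {suc n} f≤b = +-mono-≤ (f≤b zero) (∑-≤-* (f≤b ∘ suc))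

∑∑-distrib-+ : ∀ {m n} (f g : Fin m → Fin n → ℕ) →
  ∑[ i < m ] ∑[ j < n ] (f i j + g i j) ≡ ∑[ i < m ] ∑[ j < n ] f i j + ∑[ i < m ] ∑[ j < n ] g i j
∑∑-distrib-+ {n = n} f g = trans (sum-cong-≗ (λ i → ∑-distrib-+ (f i) (g i)))
  (∑-distrib-+ (λ i → ∑[ j < n ] f i j) (λ i → ∑[ j < n ] g i j))

∑-sum-comm : ∀ {A : Set} {n} (f : Fin n → A → ℕ) xs →
  ∑[ i < n ] sum (map (f i) xs) ≡ sum (map (λ x → ∑[ i < n ] f i x) xs)
∑-sum-comm {n = n} f []       = sum-replicate-zero n
∑-sum-comm         f (x ∷ xs) =
  trans (∑-distrib-+ (λ i → f i x) (λ i → sum (map (f i) xs))) (cong (_ +_) (∑-sum-comm f xs))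

sum-map-≤ : ∀ {A : Set} {f : A → ℕ} {b} xs → (∀ {x} → x ∈ xs → f x ≤ b) →
  sum (map f xs) ≤ length xs * b
sum-map-≤ []       _   = z≤n
sum-map-≤ (x ∷ xs) f≤b = +-mono-≤ (f≤b (here refl)) (sum-map-≤ xs (f≤b ∘ there))

sum-tabulate : ∀ {n} (f : Fin n → ℕ) → sum (tabulate f) ≡ ∑[ i < n ] f i
sum-tabulate {zero}  f = refl
sum-tabulate {suc n} f = cong (f zero +_) (sum-tabulate (f ∘ suc))

sum-map-allFin : ∀ n (f : Fin n → ℕ) → sum (map f (allFin n)) ≡ ∑[ i < n ] f i
sum-map-allFin n f = trans (cong sum (map-tabulate (λ i → i) f)) (sum-tabulate f)

sum-map-cartesianProduct : ∀ {A B : Set} (f : A × B → ℕ) xs ys →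
  sum (map f (cartesianProduct xs ys)) ≡ sum (map (λ x → sum (map (λ y → f (x , y)) ys)) xs)
sum-map-cartesianProduct f []       ys = refl
sum-map-cartesianProduct f (x ∷ xs) ys = begin
  sum (map f (map (x ,_) ys ++ cartesianProduct xs ys))
    ≡⟨ cong sum (map-++ f (map (x ,_) ys) _) ⟩
  sum (map f (map (x ,_) ys) ++ map f (cartesianProduct xs ys))
    ≡⟨ sum-++ (map f (map (x ,_) ys)) _ ⟩
  sum (map f (map (x ,_) ys)) + sum (map f (cartesianProduct xs ys))
    ≡⟨ cong₂ _+_ (cong sum (sym (map-∘ ys))) (sum-map-cartesianProduct f xs ys) ⟩
  sum (map (λ y → f (x , y)) ys) + sum (map (λ x → sum (map (λ y → f (x , y)) ys)) xs) ∎
  where open ≡-Reasoning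

length-filterᵇ : ∀ {A : Set} (p : A → Bool) xs → length (filterᵇ p xs) ≡ sum (map (indicator ∘ p) xs)
length-filterᵇ p []       = refl
length-filterᵇ p (x ∷ xs) with p x
... | true  = cong suc (length-filterᵇ p xs)
... | false = length-filterᵇ p xs

indicator-∧-any : ∀ {A : Set} b (p : A → Bool) xs →
  indicator (b ∧ any p xs) ≤ sum (map (λ x → indicator (b ∧ p x)) xs)
indicator-∧-any false p xs       = z≤n
indicator-∧-any true  p []       = z≤n
indicator-∧-any true  p (x ∷ xs) with p x
... | true  = s≤s z≤n
... | false = indicator-∧-any true p xs

any-true : ∀ {A : Set} (p : A → Bool) {x} xs → x ∈ xs → p x ≡ true → any p xs ≡ true
any-true p (y ∷ ys) (here refl) px rewrite px = refl
any-true p (y ∷ ys) (there x∈) px with p y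
... | true  = refl
... | false = any-true p ys x∈ px

_<ᶠ_ : ∀ {n} → Fin n → Fin n → Bool
u <ᶠ v = toℕ u <ᵇ toℕ v

distinct : ∀ {n} → Fin n → Fin n → Bool
distinct u v = (u <ᶠ v) ∨ (v <ᶠ u)

numEdges≡∑∑ : ∀ {n} (G : Graph n) → numEdges G ≡ ∑[ u < n ] ∑[ v < n ] indicator ((u <ᶠ v) ∧ adj G u v)
numEdges≡∑∑ {n} G = begin
  length (filterᵇ adjacentPair (cartesianProduct (allFin n) (allFin n)))
    ≡⟨ length-filterᵇ adjacentPair (cartesianProduct (allFin n) (allFin n)) ⟩
  sum (map (indicator ∘ adjacentPair) (cartesianProduct (allFin n) (allFin n)))
    ≡⟨ sum-map-cartesianProduct (indicator ∘ adjacentPair) (allFin n) (allFin n) ⟩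
  sum (map (λ u → sum (map (λ v → indicator (adjacentPair (u , v))) (allFin n))) (allFin n))
    ≡⟨ sum-map-allFin n _ ⟩
  ∑[ u < n ] sum (map (λ v → indicator (adjacentPair (u , v))) (allFin n))
    ≡⟨ sum-cong-≗ (λ u → sum-map-allFin n (λ v → indicator (adjacentPair (u , v)))) ⟩
  ∑[ u < n ] ∑[ v < n ] indicator ((u <ᶠ v) ∧ adj G u v) ∎
  where
  open ≡-Reasoning
  adjacentPair : Fin n × Fin n → Bool
  adjacentPair (u , v) = (u <ᶠ v) ∧ adj G u v

<ᶠ⇒≢ : ∀ {n} {u v : Fin n} → (u <ᶠ v) ≡ true → u ≢ v
<ᶠ⇒≢ {u = u} u<v refl = <-irrefl refl (<ᵇ⇒< (toℕ u) (toℕ u) (Equivalence.from T-≡ u<v))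

<ᶠ-asym : ∀ {n} (u v : Fin n) → (u <ᶠ v) ≡ true → (v <ᶠ u) ≡ true → ⊥
<ᶠ-asym u v u<v v<u =
  <-asym (<ᵇ⇒< (toℕ u) (toℕ v) (Equivalence.from T-≡ u<v))
         (<ᵇ⇒< (toℕ v) (toℕ u) (Equivalence.from T-≡ v<u))

indicator-∧-split : ∀ a b c d → (a ≡ true → b ≡ true → c ≡ true ⊎ d ≡ true) →
  indicator (a ∧ b) ≤ indicator (a ∧ c) + indicator (a ∧ d)
indicator-∧-split false _     _ _ _ = z≤n
indicator-∧-split true  false _ _ _ = z≤n
indicator-∧-split true  true  c d h with h refl refl
... | inj₁ refl = s≤s z≤n
... | inj₂ refl = m≤n+m 1 (indicator c)

indicator-∨-∧ : ∀ a b c → (a ≡ true → b ≡ true → ⊥) →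
  indicator (a ∧ c) + indicator (b ∧ c) ≤ indicator ((a ∨ b) ∧ c)
indicator-∨-∧ true  true  _ both = ⊥-elim (both refl refl)
indicator-∨-∧ true  false c _    = ≤-reflexive (+-identityʳ (indicator c))
indicator-∨-∧ false _     _ _    = ≤-refl

∑-unordered≤ordered : ∀ {n} (r : Fin n → Fin n → Bool) →
  ∑[ u < n ] ∑[ v < n ] (indicator ((u <ᶠ v) ∧ r u v) + indicator ((u <ᶠ v) ∧ r v u)) ≤
  ∑[ u < n ] ∑[ v < n ] indicator (distinct u v ∧ r u v)
∑-unordered≤ordered {n} r = begin
  ∑[ u < n ] ∑[ v < n ] (indicator ((u <ᶠ v) ∧ r u v) + indicator ((u <ᶠ v) ∧ r v u))
    ≡⟨ ∑∑-distrib-+ (λ u v → indicator ((u <ᶠ v) ∧ r u v)) (λ u v → indicator ((u <ᶠ v) ∧ r v u)) ⟩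
  ∑[ u < n ] ∑[ v < n ] indicator ((u <ᶠ v) ∧ r u v) + ∑[ u < n ] ∑[ v < n ] indicator ((u <ᶠ v) ∧ r v u)
    ≡⟨ cong (∑[ u < n ] ∑[ v < n ] indicator ((u <ᶠ v) ∧ r u v) +_)
            (∑-comm (λ u v → indicator ((u <ᶠ v) ∧ r v u))) ⟩
  ∑[ u < n ] ∑[ v < n ] indicator ((u <ᶠ v) ∧ r u v) + ∑[ u < n ] ∑[ v < n ] indicator ((v <ᶠ u) ∧ r u v)
    ≡⟨ ∑∑-distrib-+ (λ u v → indicator ((u <ᶠ v) ∧ r u v)) (λ u v → indicator ((v <ᶠ u) ∧ r u v)) ⟨
  ∑[ u < n ] ∑[ v < n ] (indicator ((u <ᶠ v) ∧ r u v) + indicator ((v <ᶠ u) ∧ r u v))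
    ≤⟨ ∑-mono-≤ (λ u → ∑-mono-≤ (λ v → indicator-∨-∧ (u <ᶠ v) (v <ᶠ u) (r u v) (<ᶠ-asym u v))) ⟩
  ∑[ u < n ] ∑[ v < n ] indicator (distinct u v ∧ r u v) ∎
  where open ≤-Reasoning

∑-distinct : ∀ {n} (b : Fin n → Bool) u → b u ≡ true →
  ∑[ v < n ] indicator (b v) ≡ suc (∑[ v < n ] indicator (distinct u v ∧ b v))
∑-distinct b zero    bu rewrite bu = refl
∑-distinct b (suc u) bu = trans (cong (indicator (b zero) +_) (∑-distinct (b ∘ suc) u bu)) (+-suc _ _)

∣tabulate∣ : ∀ {n} (b : Fin n → Bool) → Subset.∣ Vec.tabulate b ∣ ≡ ∑[ v < n ] indicator (b v)
∣tabulate∣ {zero}  b = refl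
∣tabulate∣ {suc n} b with b zero
... | true  = cong suc (∣tabulate∣ (b ∘ suc))
... | false = ∣tabulate∣ (b ∘ suc)

-- The edge bound

module _ {n} {G : Graph n} (R : EPGRep G) where

  open DecMembership _≟ₑ_ using (_∈?_)

  start : Fin n → Point
  start u = proj₁ (walk-trace (proj₁ (isPath R u)))

  directions : Fin n → List Dir
  directions u = proj₁ (proj₂ (walk-trace (proj₁ (isPath R u))))

  path≡trace : ∀ u → path R u ≡ trace (start u) (directions u)
  path≡trace u = proj₂ (proj₂ (walk-trace (proj₁ (isPath R u))))

  edgesOf : Fin n → List UnitEdge
  edgesOf u = stepEdges (start u) (directions u)

  lowestOf : Fin n → List UnitEdge
  lowestOf u = lowestEdges (start u) (directions u)

  uses : UnitEdge → Fin n → Bool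
  uses e v = does (e ∈? edgesOf v)

  charged : Fin n → Fin n → Bool
  charged u v = any (λ e → uses e v) (lowestOf u)

  lowestOf-length : ∀ {k} → (∀ u → bends (path R u) ≤ k) → ∀ u → length (lowestOf u) ≤ suc k
  lowestOf-length bends≤k u =
    ≤-trans (lowestEdges-length (start u) (directions u) (subst Unique (path≡trace u) (proj₂ (isPath R u))))
            (s≤s (subst (λ P → bends P ≤ _) (path≡trace u) (bends≤k u)))

  adjacent⇒charged : ∀ {u v} → (u <ᶠ v) ≡ true → adj G u v ≡ true →
    charged u v ≡ true ⊎ charged v u ≡ true
  adjacent⇒charged {u} {v} u<v uv with Equivalence.to (correct R u v (<ᶠ⇒≢ u<v)) uv
  ... | a , b , ab∈u , ab∈v
    with shared-stepEdge _ _ _ _ (subst (λ P → UsesEdge P a b) (path≡trace u) ab∈u)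
                                 (subst (λ P → UsesEdge P a b) (path≡trace v) ab∈v)
  ... | e , e∈u , e∈v with shared-survivor height height-predEdge< e∈u e∈v
  ... | z , inj₁ (z-lowest , z∈v) = inj₁ (any-true _ (lowestOf u) z-lowest (dec-true (z ∈? edgesOf v) z∈v))
  ... | z , inj₂ (z∈u , z-lowest) = inj₂ (any-true _ (lowestOf v) z-lowest (dec-true (z ∈? edgesOf u) z∈u))

  users-clique : ∀ e → IsClique G (Vec.tabulate (uses e))
  users-clique e a b a∈ b∈ a≢b =
    Equivalence.from (correct R a b a≢b) (proj₁ e , tip e , on-path a∈ , on-path b∈)
    where
    on-path : ∀ {v} → v Subset.∈ Vec.tabulate (uses e) → UsesEdge (path R v) (proj₁ e) (tip e)
    on-path {v} v∈ = subst (λ P → UsesEdge P (proj₁ e) (tip e)) (sym (path≡trace v))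
      (stepEdge⇒uses _ _ (does⇒ (e ∈? edgesOf v) (trans (sym (lookup∘tabulate (uses e) v)) ([]=⇒lookup v∈))))

  charges-per-vertex : ∀ {w} → IsCliqueNumber G w → ∀ u →
    ∑[ v < n ] indicator (distinct u v ∧ charged u v) ≤ length (lowestOf u) * (w ∸ 1)
  charges-per-vertex {w} clique-number u = begin
    ∑[ v < n ] indicator (distinct u v ∧ charged u v)
      ≤⟨ ∑-mono-≤ (λ v → indicator-∧-any (distinct u v) (λ e → uses e v) (lowestOf u)) ⟩
    ∑[ v < n ] sum (map (λ e → indicator (distinct u v ∧ uses e v)) (lowestOf u))
      ≡⟨ ∑-sum-comm (λ v e → indicator (distinct u v ∧ uses e v)) (lowestOf u) ⟩
    sum (map (λ e → ∑[ v < n ] indicator (distinct u v ∧ uses e v)) (lowestOf u))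
      ≤⟨ sum-map-≤ (lowestOf u) other-users ⟩
    length (lowestOf u) * (w ∸ 1) ∎
    where
    open ≤-Reasoning
    other-users : ∀ {e} → e ∈ lowestOf u → ∑[ v < n ] indicator (distinct u v ∧ uses e v) ≤ w ∸ 1
    other-users {e} e∈ = ∸-monoˡ-≤ 1 (begin
      suc (∑[ v < n ] indicator (distinct u v ∧ uses e v))
        ≡⟨ ∑-distinct (uses e) u (dec-true (e ∈? edgesOf u) (survivors-⊆ nothing (edgesOf u) e∈)) ⟨
      ∑[ v < n ] indicator (uses e v)
        ≡⟨ ∣tabulate∣ (uses e) ⟨
      Subset.∣ Vec.tabulate (uses e) ∣
        ≤⟨ proj₂ clique-number _ (users-clique e) ⟩
      w ∎)

  numEdges≤charges : numEdges G ≤ ∑[ u < n ] ∑[ v < n ] indicator (distinct u v ∧ charged u v)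
  numEdges≤charges = begin
    numEdges G
      ≡⟨ numEdges≡∑∑ G ⟩
    ∑[ u < n ] ∑[ v < n ] indicator ((u <ᶠ v) ∧ adj G u v)
      ≤⟨ ∑-mono-≤ (λ u → ∑-mono-≤ (λ v →
           indicator-∧-split (u <ᶠ v) (adj G u v) (charged u v) (charged v u) adjacent⇒charged)) ⟩
    ∑[ u < n ] ∑[ v < n ] (indicator ((u <ᶠ v) ∧ charged u v) + indicator ((u <ᶠ v) ∧ charged v u))
      ≤⟨ ∑-unordered≤ordered charged ⟩
    ∑[ u < n ] ∑[ v < n ] indicator (distinct u v ∧ charged u v) ∎
    where open ≤-Reasoning

mainTheorem14 : (k n : ℕ) (G : Graph n) → IsBkEPG k G →
    (w : ℕ) → IsCliqueNumber G w →
    numEdges G ≤ suc k * (w ∸ 1) * n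
mainTheorem14 k n G (R , bends≤k) w clique-number = begin
  numEdges G
    ≤⟨ numEdges≤charges R ⟩
  ∑[ u < n ] ∑[ v < n ] indicator (distinct u v ∧ charged R u v)
    ≤⟨ ∑-≤-* (λ u → ≤-trans (charges-per-vertex R clique-number u)
                            (*-monoˡ-≤ (w ∸ 1) (lowestOf-length R bends≤k u))) ⟩
  n * (suc k * (w ∸ 1))
    ≡⟨ *-comm n _ ⟩
  suc k * (w ∸ 1) * n ∎
  where open ≤-Reasoning
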